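{- Let $\pi$ be a primary prime of $\mathbb Z[i]$ with positive imaginary part and let $p=\mathbf N\pi$. Then $x\mapsto\left(\frac{x}{\pi}\right)_2$ and $x\mapsto\left(\frac{\mathbf N x}{p}\right)$ are different non-trivial quadratic characters on $\left(\mathbb Z[i]/p\mathbb Z[i]\right)^\times$.
   Context: A Gaussian integer is primary if it is $\equiv1\pmod{2+2i}$. $\mathbf N$ is the norm from $\mathbb Q(i)$ to $\mathbb Q$. For $\alpha\in\mathbb Z[i]$ and a prime $\lambda$ prime to $1+i$, $\left(\frac\alpha\lambda\right)_2\in\{0,\pm1\}$ is defined by $\left(\frac\alpha\lambda\right)_2\equiv\alpha^{(\mathbf N\lambda-1)/2}\pmod\lambda$. $\left(\frac{\cdot}{p}\right)$ is the Legendre symbol. -}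

module Defs where

open import Data.Nat as ℕ using (ℕ; zero; suc; _∸_)
open import Data.Nat.DivMod using (_/_)
open import Data.Integer as ℤ using (ℤ; +_; -_; ∣_∣) renaming (_+_ to _+ℤ_; _*_ to _*ℤ_; _-_ to _-ℤ_; _<_ to _<ℤ_)
import Data.Integer.Divisibility as ℤDiv
open import Data.Product using (Σ; ∃; _×_; _,_)
open import Data.Sum using (_⊎_)
open import Relation.Nullary using (¬_)
open import Relation.Binary.PropositionalEquality using (_≡_; _≢_)

record ℤ[i] : Set where
  constructor _+_i
  field
    re : ℤ
    im : ℤ
open ℤ[i] public

infixl 6 _+ᵍ_ _-ᵍ_
infixl 7 _*ᵍ_
infixr 8 _^ᵍ_

_+ᵍ_ : ℤ[i] → ℤ[i] → ℤ[i]
(a + b i) +ᵍ (c + d i) = (a +ℤ c) + (b +ℤ d) i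

-ᵍ_ : ℤ[i] → ℤ[i]
-ᵍ (a + b i) = (- a) + (- b) i

_-ᵍ_ : ℤ[i] → ℤ[i] → ℤ[i]
x -ᵍ y = x +ᵍ (-ᵍ y)

_*ᵍ_ : ℤ[i] → ℤ[i] → ℤ[i]
(a + b i) *ᵍ (c + d i) = ((a *ℤ c) -ℤ (b *ℤ d)) + ((a *ℤ d) +ℤ (b *ℤ c)) i

ι : ℤ → ℤ[i]
ι a = a + (+ 0) i

0ᵍ 1ᵍ : ℤ[i]
0ᵍ = ι (+ 0)
1ᵍ = ι (+ 1)

_^ᵍ_ : ℤ[i] → ℕ → ℤ[i]
x ^ᵍ zero = 1ᵍ
x ^ᵍ suc n = x *ᵍ (x ^ᵍ n)

N : ℤ[i] → ℤ
N (a + b i) = (a *ℤ a) +ℤ (b *ℤ b)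

_∣ᵍ_ : ℤ[i] → ℤ[i] → Set
μ ∣ᵍ α = ∃ λ γ → α ≡ μ *ᵍ γ

infix 4 _≡ᵍ_[mod_]
_≡ᵍ_[mod_] : ℤ[i] → ℤ[i] → ℤ[i] → Set
α ≡ᵍ β [mod μ ] = μ ∣ᵍ (α -ᵍ β)

GaussianPrime : ℤ[i] → Set
GaussianPrime π = (π ≢ 0ᵍ) × (¬ (π ∣ᵍ 1ᵍ))
  × (∀ α β → π ∣ᵍ (α *ᵍ β) → (π ∣ᵍ α) ⊎ (π ∣ᵍ β))

Primary : ℤ[i] → Set
Primary π = π ≡ᵍ 1ᵍ [mod ((+ 2) + (+ 2) i) ]

QRSymbol₂ : ℤ[i] → ℤ[i] → ℤ → Set
QRSymbol₂ α λ' s = (s ≡ + 0 ⊎ s ≡ + 1 ⊎ s ≡ - (+ 1))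
  × (α ^ᵍ ((∣ N λ' ∣ ∸ 1) / 2) ≡ᵍ ι s [mod λ' ])

Legendre : ℤ → ℤ → ℤ → Set
Legendre a p s =
    (p ℤDiv.∣ a × s ≡ + 0)
  ⊎ (¬ (p ℤDiv.∣ a) × (∃ λ y → p ℤDiv.∣ ((y *ℤ y) -ℤ a)) × s ≡ + 1)
  ⊎ (¬ (p ℤDiv.∣ a) × ¬ (∃ λ y → p ℤDiv.∣ ((y *ℤ y) -ℤ a)) × s ≡ - (+ 1))

UnitMod : ℤ[i] → ℤ[i] → Set
UnitMod μ x = ∃ λ y → (x *ᵍ y) ≡ᵍ 1ᵍ [mod μ ]

IsQuadraticCharacter : ℤ[i] → (ℤ[i] → ℤ) → Set
IsQuadraticCharacter μ χ =
    (∀ x y → UnitMod μ x → UnitMod μ y → x ≡ᵍ y [mod μ ] → χ x ≡ χ y)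
  × (∀ x → UnitMod μ x → χ x ≡ + 1 ⊎ χ x ≡ - (+ 1))
  × (∀ x y → UnitMod μ x → UnitMod μ y → χ (x *ᵍ y) ≡ χ x *ℤ χ y)

NonTrivial : ℤ[i] → (ℤ[i] → ℤ) → Set
NonTrivial μ χ = ∃ λ x → UnitMod μ x × χ x ≢ + 1

Different : ℤ[i] → (ℤ[i] → ℤ) → (ℤ[i] → ℤ) → Set
Different μ χ ψ = ∃ λ x → UnitMod μ x × χ x ≢ ψ x

DifferentNonTrivialQuadChars : ℤ[i] → (ℤ[i] → ℤ) → (ℤ[i] → ℤ) → Set
DifferentNonTrivialQuadChars μ χ₁ χ₂ =
  IsQuadraticCharacter μ χ₁ × IsQuadraticCharacter μ χ₂
  × NonTrivial μ χ₁ × NonTrivial μ χ₂ × Different μ χ₁ χ₂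

IsSymbolMap : ℤ[i] → ℤ[i] → (ℤ[i] → ℤ) → Set
IsSymbolMap π μ χ = ∀ x → UnitMod μ x → QRSymbol₂ x π (χ x)

IsNormLegendreMap : ℤ → ℤ[i] → (ℤ[i] → ℤ) → Set
IsNormLegendreMap p μ χ = ∀ x → UnitMod μ x → Legendre (N x) p (χ x)

module Submission where

-- Write π = u + v i and p = N π = 2k + 1. As π is prime and u, v ≠ 0, gcd (u, v) = 1, so every integer
-- divisible by π is divisible by p, and p is a rational prime. Then J ≡ -u/v (mod p) satisfies J² ≡ -1,
-- and a + b i ↦ a + b J identifies ℤ[i]/(π) with ℤ/p. Hence (x/π)₂ ≡ (a + b J)ᵏ, while Euler's criterion
-- (from Fermat's little theorem and Lagrange's bound on the roots of xᵏ - 1) gives (N x / p) ≡ (N x)ᵏ: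
-- both are k-th powers of multiplicative maps to ℤ/p, hence quadratic characters. At a non-square a
-- the first is -1 and the second is (a²/p) = 1; an element w with N w ≡ a shows the second is non-trivial.

open import Defs renaming (_+_i to _+_𝑖)

open import Algebra.Bundles using (CommutativeSemiring)
open import Algebra.Bundles.Raw using (RawMonoid)
open import Algebra.Morphism.Structures using (IsMonoidHomomorphism)
open import Algebra.Structures using (IsCommutativeSemiring)
open import Data.Empty using (⊥; ⊥-elim)
open import Data.Fin as Fin using (Fin; zero; suc; toℕ; fromℕ; inject₁)
import Data.Fin.Properties as Fin
open import Data.Integer as ℤ using (ℤ; +_; -_; _+_; _*_; _-_; _^_; ∣_∣; _<_)
open import Data.Integer.DivMod using (_%ℕ_; _/ℕ_; a≡a%ℕn+[a/ℕn]*n; n%ℕd<d)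
import Data.Integer.Divisibility as Unsigned
open import Data.Integer.Divisibility.Signed
  using (_∣_; divides; ∣⇒∣ᵤ; ∣ᵤ⇒∣; ∣-refl; ∣m∣n⇒∣m+n; ∣m⇒∣-m; ∣m⇒∣m*n; ∣n⇒∣m*n)
import Data.Integer.Properties as ℤ
open import Data.Integer.Tactic.RingSolver using (solve-∀)
open import Data.Nat as ℕ using (ℕ; zero; suc; _≤_; z≤n; s≤s; z<s; s<s)
open import Data.Nat.Combinatorics using (_C_; nCn≡1; nC1≡n; k>n⇒nCk≡0; nCk+nC[k+1]≡[n+1]C[k+1])
import Data.Nat.Divisibility as ℕ
import Data.Nat.DivMod as ℕ
open import Data.Nat.GCD using (gcd; gcd[m,n]∣m; gcd[m,n]∣n; gcd[m,n]≢0; gcd-greatest; c*gcd[m,n]≡gcd[cm,cn])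
import Data.Nat.Properties as ℕ
open import Data.Nat.Tactic.RingSolver renaming (solve-∀ to ℕ-solve-∀) using ()
open import Data.Product using (∃; _×_; _,_; proj₁; proj₂)
open import Data.Sum as Sum using (_⊎_; inj₁; inj₂; [_,_]′)
open import Data.Vec using (Vec; []; _∷_)
open import Function using (id; _∘_)
open import Function.Bundles using (_⇔_; mk⇔; Equivalence)
open import Relation.Binary.Bundles using (Setoid)
open import Relation.Binary.PropositionalEquality
  using (_≡_; _≢_; refl; sym; trans; cong; cong₂; subst; module ≡-Reasoning)
import Relation.Binary.Reasoning.Setoid as SetoidReasoning
open import Relation.Binary.Structures using (IsEquivalence)
open import Relation.Nullary using (¬_; Dec; yes; no; contradiction)
open import Relation.Nullary.Decidable using (¬?; decidable-stable; map′)

-- Congruences modulo an integer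

module Modulo (p : ℤ) where

  infix 4 _≈_
  record _≈_ (a b : ℤ) : Set where
    constructor mod
    field divides-difference : p ∣ a - b
  open _≈_ public

  private
    ∣-by : ∀ {a b} → a ≡ b → p ∣ a → p ∣ b
    ∣-by = subst (p ∣_)

  ≡⇒≈ : ∀ {a b} → a ≡ b → a ≈ b
  ≡⇒≈ {a} refl = mod (divides (+ 0) (ℤ.+-inverseʳ a))

  ≈-refl : ∀ {a} → a ≈ a
  ≈-refl = ≡⇒≈ refl

  ≈-sym : ∀ {a b} → a ≈ b → b ≈ a
  ≈-sym {a} {b} (mod d) = mod (∣-by (negate a b) (∣m⇒∣-m d))
    where
    negate : ∀ a b → - (a - b) ≡ b - a
    negate = solve-∀

  ≈-trans : ∀ {a b c} → a ≈ b → b ≈ c → a ≈ c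
  ≈-trans {a} {b} {c} (mod d) (mod e) = mod (∣-by (telescope a b c) (∣m∣n⇒∣m+n d e))
    where
    telescope : ∀ a b c → (a - b) + (b - c) ≡ a - c
    telescope = solve-∀

  +-cong : ∀ {a b c d} → a ≈ b → c ≈ d → a + c ≈ b + d
  +-cong {a} {b} {c} {d} (mod e) (mod f) = mod (∣-by (regroup a b c d) (∣m∣n⇒∣m+n e f))
    where
    regroup : ∀ a b c d → (a - b) + (c - d) ≡ (a + c) - (b + d)
    regroup = solve-∀

  *-cong : ∀ {a b c d} → a ≈ b → c ≈ d → a * c ≈ b * d
  *-cong {a} {b} {c} {d} (mod e) (mod f) =
    mod (∣-by (regroup a b c d) (∣m∣n⇒∣m+n (∣m⇒∣m*n c e) (∣n⇒∣m*n b f)))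
    where
    regroup : ∀ a b c d → (a - b) * c + b * (c - d) ≡ a * c - b * d
    regroup = solve-∀

  +-congˡ : ∀ a {b c} → b ≈ c → a + b ≈ a + c
  +-congˡ a = +-cong (≈-refl {a})

  *-congˡ : ∀ a {b c} → b ≈ c → a * b ≈ a * c
  *-congˡ a = *-cong (≈-refl {a})

  -‿cong : ∀ {a b} → a ≈ b → - a ≈ - b
  -‿cong {a} {b} (mod e) = mod (∣-by (negate a b) (∣m⇒∣-m e))
    where
    negate : ∀ a b → - (a - b) ≡ - a - - b
    negate = solve-∀

  ^-cong : ∀ {a b} n → a ≈ b → a ^ n ≈ b ^ n
  ^-cong zero    _ = ≈-refl
  ^-cong (suc n) e = *-cong e (^-cong n e)

  ∣⇒≈0 : ∀ {a} → p ∣ a → a ≈ + 0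
  ∣⇒≈0 {a} d = mod (∣-by (sym (ℤ.+-identityʳ a)) d)

  ≈0⇒∣ : ∀ {a} → a ≈ + 0 → p ∣ a
  ≈0⇒∣ {a} (mod d) = ∣-by (ℤ.+-identityʳ a) d

  ≈-isEquivalence : IsEquivalence _≈_
  ≈-isEquivalence = record { refl = ≈-refl ; sym = ≈-sym ; trans = ≈-trans }

  ≈-setoid : Setoid _ _
  ≈-setoid = record { isEquivalence = ≈-isEquivalence }

  module ≈-Reasoning = SetoidReasoning ≈-setoid

  +-*-isCommutativeSemiring : IsCommutativeSemiring _≈_ _+_ _*_ (+ 0) (+ 1)
  +-*-isCommutativeSemiring = record
    { isSemiring = record
      { isSemiringWithoutAnnihilatingZero = record
        { +-isCommutativeMonoid = record
          { isMonoid = record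
            { isSemigroup = record
              { isMagma = record { isEquivalence = ≈-isEquivalence ; ∙-cong = +-cong }
              ; assoc = λ a b c → ≡⇒≈ (ℤ.+-assoc a b c) }
            ; identity = (λ a → ≡⇒≈ (ℤ.+-identityˡ a)) , (λ a → ≡⇒≈ (ℤ.+-identityʳ a)) }
          ; comm = λ a b → ≡⇒≈ (ℤ.+-comm a b) }
        ; *-cong = *-cong
        ; *-assoc = λ a b c → ≡⇒≈ (ℤ.*-assoc a b c)
        ; *-identity = (λ a → ≡⇒≈ (ℤ.*-identityˡ a)) , (λ a → ≡⇒≈ (ℤ.*-identityʳ a))
        ; distrib = (λ a b c → ≡⇒≈ (ℤ.*-distribˡ-+ a b c)) , (λ a b c → ≡⇒≈ (ℤ.*-distribʳ-+ a b c)) }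
      ; zero = (λ a → ≡⇒≈ (ℤ.*-zeroˡ a)) , (λ a → ≡⇒≈ (ℤ.*-zeroʳ a)) }
    ; *-comm = λ a b → ≡⇒≈ (ℤ.*-comm a b) }

  +-*-commutativeSemiring : CommutativeSemiring _ _
  +-*-commutativeSemiring = record { isCommutativeSemiring = +-*-isCommutativeSemiring }

-- Fermat's little theorem

Euclid : ℤ → Set
Euclid p = ∀ a b → p ∣ a * b → (p ∣ a) ⊎ (p ∣ b)

[k+1]*[n+1]C[k+1]≡[n+1]*nCk : ∀ n k → suc k ℕ.* (suc n C suc k) ≡ suc n ℕ.* (n C k)
[k+1]*[n+1]C[k+1]≡[n+1]*nCk zero    zero    = refl
[k+1]*[n+1]C[k+1]≡[n+1]*nCk zero    (suc k)
  rewrite k>n⇒nCk≡0 {1} {suc (suc k)} (s<s z<s) | k>n⇒nCk≡0 {0} {suc k} z<s =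
  ℕ.*-zeroʳ (suc (suc k))
[k+1]*[n+1]C[k+1]≡[n+1]*nCk (suc n) zero
  rewrite nC1≡n (suc (suc n)) = trans (ℕ.*-identityˡ (suc (suc n))) (sym (ℕ.*-identityʳ (suc (suc n))))
[k+1]*[n+1]C[k+1]≡[n+1]*nCk (suc n) (suc k) = begin
  suc (suc k) ℕ.* (suc (suc n) C suc (suc k))
    ≡⟨ cong (suc (suc k) ℕ.*_) (nCk+nC[k+1]≡[n+1]C[k+1] (suc n) (suc k)) ⟨
  suc (suc k) ℕ.* (A ℕ.+ B)
    ≡⟨ regroup k A B ⟩
  suc k ℕ.* A ℕ.+ A ℕ.+ suc (suc k) ℕ.* B
    ≡⟨ cong₂ (λ x y → x ℕ.+ A ℕ.+ y) ([k+1]*[n+1]C[k+1]≡[n+1]*nCk n k) ([k+1]*[n+1]C[k+1]≡[n+1]*nCk n (suc k)) ⟩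
  suc n ℕ.* (n C k) ℕ.+ A ℕ.+ suc n ℕ.* (n C suc k)
    ≡⟨ regroup′ n (n C k) (n C suc k) A ⟩
  suc n ℕ.* (n C k ℕ.+ n C suc k) ℕ.+ A
    ≡⟨ cong (λ x → suc n ℕ.* x ℕ.+ A) (nCk+nC[k+1]≡[n+1]C[k+1] n k) ⟩
  suc n ℕ.* A ℕ.+ A
    ≡⟨ ℕ.+-comm (suc n ℕ.* A) A ⟩
  suc (suc n) ℕ.* A ∎
  where
  open ≡-Reasoning
  A = suc n C suc k
  B = suc n C suc (suc k)
  regroup : ∀ k A B → suc (suc k) ℕ.* (A ℕ.+ B) ≡ suc k ℕ.* A ℕ.+ A ℕ.+ suc (suc k) ℕ.* B
  regroup = ℕ-solve-∀
  regroup′ : ∀ n a b A → suc n ℕ.* a ℕ.+ A ℕ.+ suc n ℕ.* b ≡ suc n ℕ.* (a ℕ.+ b) ℕ.+ A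
  regroup′ = ℕ-solve-∀

0<n<p⇒p∤n : ∀ {p n} → 0 ℕ.< n → n ℕ.< p → ¬ (+ p ∣ + n)
0<n<p⇒p∤n {n = suc n} _ n<p p∣n = ℕ.<⇒≱ n<p (ℕ.∣⇒≤ (∣⇒∣ᵤ p∣n))

module Fermat (m : ℕ) (euclid : Euclid (+ suc m)) where

  open Modulo (+ suc m)
  open import Algebra.Properties.CommutativeSemiring.Binomial +-*-commutativeSemiring
    using (theorem; binomialTerm)
  open import Algebra.Properties.Monoid.Sum (CommutativeSemiring.+-monoid +-*-commutativeSemiring)
    using (sum; sum-init-last; sum-cong-≋; sum-replicate-zero)
  open import Data.Vec.Functional using (init)

  p∣pC[k+1] : ∀ {k} → k ℕ.< m → + suc m ∣ + (suc m C suc k)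
  p∣pC[k+1] {k} k<m =
    [ (λ p∣k+1 → contradiction p∣k+1 (0<n<p⇒p∤n z<s (s<s k<m))) , id ]′
      (euclid (+ suc k) (+ (suc m C suc k)) (divides (+ (m C k)) absorption))
    where
    absorption : + suc k * + (suc m C suc k) ≡ + (m C k) * + suc m
    absorption = begin
      + suc k * + (suc m C suc k)    ≡⟨ ℤ.pos-* (suc k) (suc m C suc k) ⟨
      + (suc k ℕ.* (suc m C suc k))  ≡⟨ cong +_ ([k+1]*[n+1]C[k+1]≡[n+1]*nCk m k) ⟩
      + (suc m ℕ.* (m C k))          ≡⟨ cong +_ (ℕ.*-comm (suc m) (m C k)) ⟩
      + ((m C k) ℕ.* suc m)          ≡⟨ ℤ.pos-* (m C k) (suc m) ⟩
      + (m C k) * + suc m            ∎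
      where open ≡-Reasoning

  -- the binomial theorem is stated with the semiring's own multiples and powers, equal to ℤ's only propositionally
  open import Algebra.Definitions.RawSemiring (CommutativeSemiring.rawSemiring +-*-commutativeSemiring)
    using () renaming (_×_ to _×ₘ_; _^_ to _^ₘ_)

  ×≡* : ∀ n a → n ×ₘ a ≡ + n * a
  ×≡* zero    a = sym (ℤ.*-zeroˡ a)
  ×≡* (suc n) a = trans (cong (λ x → a + x) (×≡* n a)) (sym (ℤ.suc-* (+ n) a))

  ^ₘ≡^ : ∀ a n → a ^ₘ n ≡ a ^ n
  ^ₘ≡^ a zero    = refl
  ^ₘ≡^ a (suc n) = cong (a *_) (^ₘ≡^ a n)

  freshmansDream : ∀ a b → (a + b) ^ suc m ≈ a ^ suc m + b ^ suc m
  freshmansDream a b = begin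
    (a + b) ^ suc m                        ≡⟨ ^ₘ≡^ (a + b) (suc m) ⟨
    (a + b) ^ₘ suc m                       ≈⟨ theorem (suc m) a b ⟩
    t 0F + sum (t ∘ Fin.suc)               ≈⟨ +-cong (≡⇒≈ first) (sum-init-last (t ∘ Fin.suc)) ⟩
    b ^ suc m + (sum middle + t lastIx)    ≈⟨ +-congˡ (b ^ suc m) (+-cong middle≈0 (≡⇒≈ final)) ⟩
    b ^ suc m + (+ 0 + a ^ suc m)          ≡⟨ solve (a ^ suc m) (b ^ suc m) ⟩
    a ^ suc m + b ^ suc m                  ∎
    where
    open ≈-Reasoning
    open import Data.Fin.Patterns using (0F)
    t = binomialTerm a b (suc m)
    middle = init (t ∘ Fin.suc)
    lastIx = Fin.suc (fromℕ m)
    solve : ∀ x y → y + (+ 0 + x) ≡ x + y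
    solve = solve-∀
    first : t 0F ≡ b ^ suc m
    first = trans (×≡* 1 (+ 1 * b ^ₘ suc m))
      (trans (ℤ.*-identityˡ _) (trans (ℤ.*-identityˡ _) (^ₘ≡^ b (suc m))))
    final : t lastIx ≡ a ^ suc m
    final rewrite Fin.toℕ-fromℕ m | nCn≡1 (suc m) | ℕ.n∸n≡0 m =
      trans (×≡* 1 (a ^ₘ suc m * + 1))
        (trans (ℤ.*-identityˡ _) (trans (ℤ.*-identityʳ _) (^ₘ≡^ a (suc m))))
    middle≈0 : sum middle ≈ + 0
    middle≈0 = ≈-trans (sum-cong-≋ vanishes) (sum-replicate-zero m)
      where
      vanishes : ∀ i → middle i ≈ + 0
      vanishes i = ≈-trans (≡⇒≈ (×≡* (suc m C suc k) (a ^ₘ suc k * b ^ₘ (m ℕ.∸ k))))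
        (∣⇒≈0 (∣m⇒∣m*n _ (p∣pC[k+1] (subst (ℕ._< m) (sym (Fin.toℕ-inject₁ i)) (Fin.toℕ<n i)))))
        where k = toℕ (inject₁ i)

  ≈%ℕ : ∀ a → a ≈ + (a %ℕ suc m)
  ≈%ℕ a = mod (divides (a /ℕ suc m) (begin
    a - + r                              ≡⟨ cong (_- + r) (a≡a%ℕn+[a/ℕn]*n a (suc m)) ⟩
    + r + (a /ℕ suc m) * + suc m - + r   ≡⟨ cancel (+ r) (a /ℕ suc m) (+ suc m) ⟩
    (a /ℕ suc m) * + suc m               ∎))
    where
    open ≡-Reasoning
    r = a %ℕ suc m
    cancel : ∀ r q p → r + q * p - r ≡ q * p
    cancel = solve-∀

  fermat : ∀ a → a ^ suc m ≈ a
  fermat a = ≈-trans (^-cong (suc m) (≈%ℕ a)) (≈-trans (fermatℕ (a %ℕ suc m)) (≈-sym (≈%ℕ a)))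
    where
    fermatℕ : ∀ n → (+ n) ^ suc m ≈ + n
    fermatℕ zero    = ≡⇒≈ (ℤ.*-zeroˡ ((+ 0) ^ m))
    fermatℕ (suc n) = ≈-trans (freshmansDream (+ 1) (+ n))
      (+-cong (≡⇒≈ (ℤ.^-zeroˡ (suc m))) (fermatℕ n))

  fermat-unit : ∀ {a} → ¬ (+ suc m ∣ a) → a ^ m ≈ + 1
  fermat-unit {a} p∤a = mod ([ (λ p∣a → contradiction p∣a p∤a) , id ]′ (euclid a (a ^ m - + 1) p∣a[a^m-1]))
    where
    p∣a[a^m-1] : + suc m ∣ a * (a ^ m - + 1)
    p∣a[a^m-1] = ≈0⇒∣ (≈-trans (≡⇒≈ (expand a (a ^ m)))
      (≈-trans (+-cong (fermat a) ≈-refl) (≡⇒≈ (ℤ.+-inverseʳ a))))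
      where
      expand : ∀ a b → a * (b - + 1) ≡ a * b - a
      expand = solve-∀

-- Lagrange's bound on the number of roots

eval : ∀ {n} → Vec ℤ n → ℤ → ℤ
eval []      z = + 0
eval (c ∷ f) z = c + z * eval f z

-- synthetic division: quotient r f are the coefficients of (c ∷ f) div (x - r), for any c
quotient : ∀ {n} → ℤ → Vec ℤ n → Vec ℤ n
quotient r []      = []
quotient r (c ∷ f) = eval (c ∷ f) r ∷ quotient r f

factor-theorem : ∀ {n} r z c (f : Vec ℤ n) →
  eval (c ∷ f) z ≡ (z - r) * eval (quotient r f) z + eval (c ∷ f) r
factor-theorem r z c f = trans (cong (_+_ c) (shift f)) (swap c ((z - r) * eval (quotient r f) z) (r * eval f r))
  where
  swap : ∀ a b d → a + (b + d) ≡ b + (a + d)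
  swap = solve-∀
  shift : ∀ {n} (f : Vec ℤ n) → z * eval f z ≡ (z - r) * eval (quotient r f) z + r * eval f r
  shift []      = step r z
    where
    step : ∀ r z → z * + 0 ≡ (z - r) * + 0 + r * + 0
    step = solve-∀
  shift (d ∷ f) = step z r d (eval f z) (eval (quotient r f) z) (eval f r) (shift f)
    where
    step : ∀ z r d E Q R → z * E ≡ (z - r) * Q + r * R →
           z * (d + z * E) ≡ (z - r) * ((d + r * R) + z * Q) + r * (d + r * R)
    step z r d E Q R hyp rewrite hyp = expand z r d Q R
      where
      expand : ∀ z r d Q R → z * (d + ((z - r) * Q + r * R)) ≡ (z - r) * ((d + r * R) + z * Q) + r * (d + r * R)
      expand = solve-∀

xⁿ : ∀ n → Vec ℤ (suc n)
xⁿ zero    = + 1 ∷ []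
xⁿ (suc n) = + 0 ∷ xⁿ n

xⁿ-c : ∀ n → ℤ → Vec ℤ (suc n)
xⁿ-c zero    c = + 1 - c ∷ []
xⁿ-c (suc n) c = - c ∷ xⁿ n

eval-xⁿ : ∀ n z → eval (xⁿ n) z ≡ z ^ n
eval-xⁿ zero    z = cong (_+_ (+ 1)) (ℤ.*-zeroʳ z)
eval-xⁿ (suc n) z = trans (ℤ.+-identityˡ _) (cong (z *_) (eval-xⁿ n z))

eval-xⁿ-c : ∀ n c z → eval (xⁿ-c n c) z ≡ z ^ n - c
eval-xⁿ-c zero    c z = trans (cong (_+_ (+ 1 - c)) (ℤ.*-zeroʳ z)) (ℤ.+-identityʳ (+ 1 - c))
eval-xⁿ-c (suc n) c z = trans (cong (λ e → - c + z * e) (eval-xⁿ n z)) (ℤ.+-comm (- c) _)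

module Lagrange (p : ℤ) (euclid : Euclid p) where

  open Modulo p
  open ≈-Reasoning

  vanishes-everywhere : ∀ {n} (f : Vec ℤ n) (r : Fin n → ℤ) →
    (∀ i → eval f (r i) ≈ + 0) → (∀ {i j} → r i ≈ r j → i ≡ j) → ∀ z → eval f z ≈ + 0
  vanishes-everywhere []      r roots distinct z = ≈-refl
  vanishes-everywhere (c ∷ f) r roots distinct z = begin
    eval (c ∷ f) z                               ≡⟨ factor-theorem r₀ z c f ⟩
    (z - r₀) * eval q z + eval (c ∷ f) r₀        ≈⟨ +-cong (*-congˡ (z - r₀) q≈0) (roots zero) ⟩
    (z - r₀) * + 0 + + 0                         ≡⟨ annihilate (z - r₀) ⟩
    + 0                                          ∎
    where
    r₀ = r zero
    q = quotient r₀ f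
    annihilate : ∀ a → a * + 0 + + 0 ≡ + 0
    annihilate = solve-∀
    q-roots : ∀ i → eval q (r (suc i)) ≈ + 0
    q-roots i = [ (λ p∣rᵢ-r₀ → contradiction (distinct (mod p∣rᵢ-r₀)) λ ()) , ∣⇒≈0 ]′
                  (euclid (rᵢ - r₀) (eval q rᵢ) (≈0⇒∣ product≈0))
      where
      rᵢ = r (suc i)
      isolate : ∀ a b → a ≡ (a + b) - b
      isolate = solve-∀
      product≈0 : (rᵢ - r₀) * eval q rᵢ ≈ + 0
      product≈0 = begin
        (rᵢ - r₀) * eval q rᵢ                                   ≡⟨ isolate _ (eval (c ∷ f) r₀) ⟩
        ((rᵢ - r₀) * eval q rᵢ + eval (c ∷ f) r₀) - eval (c ∷ f) r₀ ≡⟨ cong (_- eval (c ∷ f) r₀) (factor-theorem r₀ rᵢ c f) ⟨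
        eval (c ∷ f) rᵢ - eval (c ∷ f) r₀                       ≈⟨ +-cong (roots (suc i)) (-‿cong (roots zero)) ⟩
        + 0                                                     ∎
    q≈0 : eval q z ≈ + 0
    q≈0 = vanishes-everywhere q (r ∘ suc) q-roots (Fin.suc-injective ∘ distinct) z

  xⁿ≈c-everywhere : ∀ n c (r : Fin (suc n) → ℤ) → (∀ i → r i ^ n ≈ c) →
    (∀ {i j} → r i ≈ r j → i ≡ j) → ∀ z → z ^ n ≈ c
  xⁿ≈c-everywhere n c r roots distinct z =
    mod (≈0⇒∣ (subst (_≈ + 0) (eval-xⁿ-c n c z) (vanishes-everywhere (xⁿ-c n c) r roots′ distinct z)))
    where
    roots′ : ∀ i → eval (xⁿ-c n c) (r i) ≈ + 0
    roots′ i = subst (_≈ + 0) (sym (eval-xⁿ-c n c (r i))) (∣⇒≈0 (divides-difference (roots i)))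

-- Euler's criterion

^-distrib-* : ∀ a b n → (a * b) ^ n ≡ a ^ n * b ^ n
^-distrib-* a b zero    = refl
^-distrib-* a b (suc n) = trans (cong ((a * b) *_) (^-distrib-* a b n)) (interchange a b (a ^ n) (b ^ n))
  where
  interchange : ∀ a b c d → (a * b) * (c * d) ≡ (a * c) * (b * d)
  interchange = solve-∀

SymbolValue : ℤ → Set
SymbolValue s = s ≡ + 0 ⊎ s ≡ + 1 ⊎ s ≡ - (+ 1)

∣symbolValue∣≤1 : ∀ {s} → SymbolValue s → ∣ s ∣ ≤ 1
∣symbolValue∣≤1 (inj₁ refl)        = z≤n
∣symbolValue∣≤1 (inj₂ (inj₁ refl)) = s≤s z≤n
∣symbolValue∣≤1 (inj₂ (inj₂ refl)) = s≤s z≤n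

symbolValue-neg : ∀ {s} → SymbolValue s → SymbolValue (- s)
symbolValue-neg (inj₁ refl)        = inj₁ refl
symbolValue-neg (inj₂ (inj₁ refl)) = inj₂ (inj₂ refl)
symbolValue-neg (inj₂ (inj₂ refl)) = inj₂ (inj₁ refl)

symbolValue-* : ∀ {s t} → SymbolValue s → SymbolValue t → SymbolValue (s * t)
symbolValue-* (inj₁ refl)        _  = inj₁ refl
symbolValue-* (inj₂ (inj₁ refl)) vt = subst SymbolValue (sym (ℤ.*-identityˡ _)) vt
symbolValue-* (inj₂ (inj₂ refl)) vt = subst SymbolValue (sym (ℤ.-1*i≡-i _)) (symbolValue-neg vt)

legendre-symbolValue : ∀ {a p s} → Legendre a p s → SymbolValue s
legendre-symbolValue (inj₁ (_ , refl))             = inj₁ refl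
legendre-symbolValue (inj₂ (inj₁ (_ , _ , refl))) = inj₂ (inj₁ refl)
legendre-symbolValue (inj₂ (inj₂ (_ , _ , refl))) = inj₂ (inj₂ refl)

module OddPrime (k : ℕ) (k≥1 : 1 ≤ k) (euclid : Euclid (+ suc (k ℕ.+ k))) where

  p : ℤ
  p = + suc (k ℕ.+ k)

  open Modulo p public
  open Fermat (k ℕ.+ k) euclid public
  open Lagrange p euclid

  p∣small⇒0 : ∀ {a} → ∣ a ∣ ℕ.< suc (k ℕ.+ k) → p ∣ a → a ≡ + 0
  p∣small⇒0 {a} ∣a∣<p p∣a with ∣ a ∣ in eq
  ... | zero  = ℤ.∣i∣≡0⇒i≡0 eq
  ... | suc _ = contradiction (ℕ.∣⇒≤ (subst (suc (k ℕ.+ k) ℕ.∣_) eq (∣⇒∣ᵤ p∣a))) (ℕ.<⇒≱ ∣a∣<p)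

  symbolValue-≈⇒≡ : ∀ {s t} → SymbolValue s → SymbolValue t → s ≈ t → s ≡ t
  symbolValue-≈⇒≡ {s} {t} vs vt (mod p∣s-t) = ℤ.i-j≡0⇒i≡j s t (p∣small⇒0 ∣s-t∣<p p∣s-t)
    where
    ∣s-t∣<p : ∣ s - t ∣ ℕ.< suc (k ℕ.+ k)
    ∣s-t∣<p = ℕ.≤-<-trans (ℕ.≤-trans (ℤ.∣i-j∣≤∣i∣+∣j∣ s t)
                (ℕ.+-mono-≤ (∣symbolValue∣≤1 vs) (∣symbolValue∣≤1 vt))) (s<s (ℕ.+-mono-≤ k≥1 k≥1))

  0≉1 : ¬ (+ 0 ≈ + 1)
  0≉1 0≈1 with () ← symbolValue-≈⇒≡ (inj₁ refl) (inj₂ (inj₁ refl)) 0≈1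

  +≈+⇒≡ : ∀ {m n} → m ℕ.< suc (k ℕ.+ k) → n ℕ.< suc (k ℕ.+ k) → + m ≈ + n → m ≡ n
  +≈+⇒≡ {m} {n} m<p n<p (mod p∣m-n) = ℤ.+-injective (ℤ.i-j≡0⇒i≡j (+ m) (+ n) (p∣small⇒0 ∣m-n∣<p p∣m-n))
    where
    ∣m-n∣<p : ∣ + m - + n ∣ ℕ.< suc (k ℕ.+ k)
    ∣m-n∣<p = subst (ℕ._< suc (k ℕ.+ k)) (cong ∣_∣ (sym (ℤ.[+m]-[+n]≡m⊖n m n)))
                (ℕ.≤-<-trans (ℤ.∣m⊝n∣≤m⊔n m n) (ℕ.⊔-lub m<p n<p))

  squares-distinct : ∀ {m n} → m ≤ k → n ≤ k → (+ m) * (+ m) ≈ (+ n) * (+ n) → m ≡ n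
  squares-distinct {m} {n} m≤k n≤k (mod p∣m²-n²) =
    [ (λ p∣m-n → +≈+⇒≡ m<p n<p (mod p∣m-n)) , sum-vanishes ]′
      (euclid (+ m - + n) (+ m + + n) (subst (p ∣_) (factor (+ m) (+ n)) p∣m²-n²))
    where
    factor : ∀ a b → a * a - b * b ≡ (a - b) * (a + b)
    factor = solve-∀
    k<p : k ℕ.< suc (k ℕ.+ k)
    k<p = s≤s (ℕ.m≤m+n k k)
    m<p = ℕ.≤-<-trans m≤k k<p
    n<p = ℕ.≤-<-trans n≤k k<p
    sum-vanishes : p ∣ + m + + n → m ≡ n
    sum-vanishes p∣m+n = trans (ℕ.m+n≡0⇒m≡0 m m+n≡0) (sym (ℕ.m+n≡0⇒n≡0 m m+n≡0))
      where
      m+n≡0 : m ℕ.+ n ≡ 0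
      m+n≡0 = +≈+⇒≡ (s≤s (ℕ.+-mono-≤ m≤k n≤k)) z<s (∣⇒≈0 p∣m+n)

  0^k≡0 : (+ 0) ^ k ≡ + 0
  0^k≡0 = 0^n≡0 k≥1
    where
    0^n≡0 : ∀ {n} → 1 ≤ n → (+ 0) ^ n ≡ + 0
    0^n≡0 (s≤s _) = refl

  at-most-k-roots : (r : Fin (suc k) → ℤ) → (∀ i → r i ^ k ≈ + 1) → ¬ (∀ {i j} → r i ≈ r j → i ≡ j)
  at-most-k-roots r roots distinct =
    0≉1 (subst (_≈ + 1) 0^k≡0 (xⁿ≈c-everywhere k (+ 1) r roots distinct (+ 0)))

  IsSquare : ℤ → Set
  IsSquare a = ∃ λ y → p Unsigned.∣ (y * y - a)

  p∤square : ∀ {y} → ¬ (p ∣ y) → ¬ (p ∣ y * y)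
  p∤square p∤y p∣y² = [ p∤y , p∤y ]′ (euclid _ _ p∣y²)

  square^k≈1 : ∀ {y} → ¬ (p ∣ y) → (y * y) ^ k ≈ + 1
  square^k≈1 {y} p∤y = subst (_≈ + 1) (trans (ℤ.^-distribˡ-+-* y k k) (sym (^-distrib-* y y k))) (fermat-unit p∤y)

  euler-square : ∀ {a} → ¬ (p ∣ a) → IsSquare a → a ^ k ≈ + 1
  euler-square p∤a (y , p∣y²-a) = ≈-trans (^-cong k (≈-sym a≈y²)) (square^k≈1 p∤y)
    where
    a≈y² = mod (∣ᵤ⇒∣ p∣y²-a)
    p∤y : ¬ (p ∣ y)
    p∤y p∣y = p∤a (≈0⇒∣ (≈-trans (≈-sym a≈y²) (*-cong (∣⇒≈0 p∣y) (∣⇒≈0 p∣y))))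

  euler-nonsquare : ∀ {a} → ¬ (p ∣ a) → ¬ IsSquare a → a ^ k ≈ - (+ 1)
  euler-nonsquare {a} p∤a nonsquare =
    [ (λ p∣A-1 → contradiction (mod p∣A-1) A≉1) , mod ]′ (euclid (A - + 1) (A + + 1) p∣A²-1)
    where
    A = a ^ k
    factor : ∀ A → A * A - + 1 ≡ (A - + 1) * (A + + 1)
    factor = solve-∀
    p∣A²-1 : p ∣ (A - + 1) * (A + + 1)
    p∣A²-1 = subst (p ∣_) (trans (cong (_- + 1) (ℤ.^-distribˡ-+-* a k k)) (factor A))
               (divides-difference (fermat-unit p∤a))
    -- a, 1², 2², …, k² would be k + 1 distinct roots of xᵏ - 1
    A≉1 : ¬ (A ≈ + 1)
    A≉1 A≈1 = at-most-k-roots r roots distinct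
      where
      r : Fin (suc k) → ℤ
      r zero    = a
      r (suc i) = (+ suc (toℕ i)) * (+ suc (toℕ i))
      i<k : ∀ (i : Fin k) → suc (toℕ i) ≤ k
      i<k = Fin.toℕ<n
      roots : ∀ i → r i ^ k ≈ + 1
      roots zero    = A≈1
      roots (suc i) = square^k≈1 (0<n<p⇒p∤n z<s (s≤s (ℕ.≤-trans (i<k i) (ℕ.m≤m+n k k))))
      nonsquare′ : ∀ {i} → a ≈ r (suc i) → ⊥
      nonsquare′ {i} a≈i² = nonsquare (+ suc (toℕ i) , ∣⇒∣ᵤ (divides-difference (≈-sym a≈i²)))
      distinct : ∀ {i j} → r i ≈ r j → i ≡ j
      distinct {zero}  {zero}  _ = refl
      distinct {zero}  {suc j} e = ⊥-elim (nonsquare′ {j} e)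
      distinct {suc i} {zero}  e = ⊥-elim (nonsquare′ {i} (≈-sym e))
      distinct {suc i} {suc j} e = cong suc (Fin.toℕ-injective (ℕ.suc-injective (squares-distinct (i<k i) (i<k j) e)))

  euler : ∀ {a s} → Legendre a p s → a ^ k ≈ s
  euler (inj₁ (p∣a , refl))                  = ≈-trans (^-cong k (∣⇒≈0 (∣ᵤ⇒∣ p∣a))) (≡⇒≈ 0^k≡0)
  euler (inj₂ (inj₁ (p∤a , square , refl)))    = euler-square (p∤a ∘ ∣⇒∣ᵤ) square
  euler (inj₂ (inj₂ (p∤a , nonsquare , refl))) = euler-nonsquare (p∤a ∘ ∣⇒∣ᵤ) nonsquare

  1+i<p : (i : Fin (suc k)) → suc (toℕ i) ℕ.< suc (k ℕ.+ k)
  1+i<p i = s≤s (ℕ.≤-trans (Fin.toℕ<n i) (ℕ.+-monoˡ-≤ k k≥1))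

  p∤1+i : (i : Fin (suc k)) → ¬ (p ∣ + suc (toℕ i))
  p∤1+i i = 0<n<p⇒p∤n z<s (1+i<p i)

  p∣? : ∀ a → Dec (p Unsigned.∣ a)
  p∣? a = suc (k ℕ.+ k) ℕ.∣? ∣ a ∣

  isSquare? : ∀ a → Dec (IsSquare a)
  isSquare? a = map′ (λ (y , d) → + toℕ y , d) representative (Fin.any? (λ y → p∣? ((+ toℕ y) * (+ toℕ y) - a)))
    where
    representative : IsSquare a → ∃ λ (y : Fin (suc (k ℕ.+ k))) → p Unsigned.∣ ((+ toℕ y) * (+ toℕ y) - a)
    representative (y , p∣y²-a) = Fin.fromℕ< r<p ,
      subst (λ n → p Unsigned.∣ ((+ n) * (+ n) - a)) (sym (Fin.toℕ-fromℕ< r<p)) (∣⇒∣ᵤ (≈0⇒∣ r²-a≈0))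
      where
      r = y %ℕ suc (k ℕ.+ k)
      r<p = n%ℕd<d y (suc (k ℕ.+ k))
      r²-a≈0 : (+ r) * (+ r) - a ≈ + 0
      r²-a≈0 = ≈-trans (+-cong (*-cong (≈-sym (≈%ℕ y)) (≈-sym (≈%ℕ y))) ≈-refl) (∣⇒≈0 (∣ᵤ⇒∣ p∣y²-a))

  legendre-1⇒p∤ : ∀ {a} → Legendre a p (- (+ 1)) → ¬ (p ∣ a)
  legendre-1⇒p∤ (inj₁ (_ , ()))
  legendre-1⇒p∤ (inj₂ (inj₁ (_ , _ , ())))
  legendre-1⇒p∤ (inj₂ (inj₂ (p∤a , _ , _))) = p∤a ∘ ∣⇒∣ᵤ

  legendre : ∀ a → ∃ (Legendre a p)
  legendre a with p∣? a | isSquare? a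
  ... | yes p∣a | _         = + 0 , inj₁ (p∣a , refl)
  ... | no p∤a  | yes sq    = + 1 , inj₂ (inj₁ (p∤a , sq , refl))
  ... | no p∤a  | no nonsq  = - (+ 1) , inj₂ (inj₂ (p∤a , nonsq , refl))

  -- among 1, …, 1 + k there is a non-square: otherwise they would be k + 1 distinct roots of xᵏ - 1
  nonsquare : ∃ λ a → Legendre a p (- (+ 1))
  nonsquare with Fin.any? (λ (i : Fin (suc k)) → ¬? (isSquare? (+ suc (toℕ i))))
  ... | yes (i , nonsq) = + suc (toℕ i) , inj₂ (inj₂ (p∤1+i i ∘ ∣ᵤ⇒∣ , nonsq , refl))
  ... | no none = ⊥-elim (at-most-k-roots r roots distinct)
    where
    r : Fin (suc k) → ℤ
    r i = + suc (toℕ i)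
    roots : ∀ i → r i ^ k ≈ + 1
    roots i = euler-square (p∤1+i i) (decidable-stable (isSquare? (r i)) (λ nonsq → none (i , nonsq)))
    distinct : ∀ {i j} → r i ≈ r j → i ≡ j
    distinct {i} {j} e = Fin.toℕ-injective (ℕ.suc-injective (+≈+⇒≡ (1+i<p i) (1+i<p j) e))

  infix 9 _⁻¹
  _⁻¹ : ℤ → ℤ
  a ⁻¹ = a ^ (k ℕ.+ k ℕ.∸ 1)

  ⁻¹-inverse : ∀ {a} → ¬ (p ∣ a) → a * a ⁻¹ ≈ + 1
  ⁻¹-inverse {a} p∤a = subst (_≈ + 1) (sym (a*a^[n∸1]≡a^n (ℕ.≤-trans k≥1 (ℕ.m≤m+n k k)))) (fermat-unit p∤a)
    where
    a*a^[n∸1]≡a^n : ∀ {n} → 1 ≤ n → a * a ^ (n ℕ.∸ 1) ≡ a ^ n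
    a*a^[n∸1]≡a^n (s≤s _) = refl

  p∣a^n⇒p∣a : ∀ {a} n → p ∣ a ^ n → p ∣ a
  p∣a^n⇒p∣a zero    p∣1    = contradiction p∣1 (0<n<p⇒p∤n z<s (s≤s (ℕ.≤-trans k≥1 (ℕ.m≤m+n k k))))
  p∣a^n⇒p∣a (suc n) p∣a^n = [ (λ p∣a → p∣a) , p∣a^n⇒p∣a n ]′ (euclid _ _ p∣a^n)

-- Gaussian integers

conj : ℤ[i] → ℤ[i]
conj (a + b 𝑖) = a + (- b) 𝑖

N-* : ∀ x y → N (x *ᵍ y) ≡ N x * N y
N-* (a + b 𝑖) (c + d 𝑖) = lagrange a b c d
  where
  lagrange : ∀ a b c d → (a * c - b * d) * (a * c - b * d) + (a * d + b * c) * (a * d + b * c)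
                         ≡ (a * a + b * b) * (c * c + d * d)
  lagrange = solve-∀

ι-* : ∀ a b → ι (a * b) ≡ ι a *ᵍ ι b
ι-* a b = cong₂ _+_𝑖 (re-eq a b) (im-eq a b)
  where
  re-eq : ∀ a b → a * b ≡ a * b - + 0 * + 0
  re-eq = solve-∀
  im-eq : ∀ a b → + 0 ≡ a * + 0 + + 0 * b
  im-eq = solve-∀

‖_‖ : ℤ[i] → ℕ
‖ a + b 𝑖 ‖ = ∣ a ∣ ℕ.* ∣ a ∣ ℕ.+ ∣ b ∣ ℕ.* ∣ b ∣

a*a≡∣a∣*∣a∣ : ∀ a → a * a ≡ + (∣ a ∣ ℕ.* ∣ a ∣)
a*a≡∣a∣*∣a∣ (+ n)    = sym (ℤ.pos-* n n)
a*a≡∣a∣*∣a∣ ℤ.-[1+ n ] = refl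

N≡‖‖ : ∀ x → N x ≡ + ‖ x ‖
N≡‖‖ (a + b 𝑖) = trans (cong₂ _+_ (a*a≡∣a∣*∣a∣ a) (a*a≡∣a∣*∣a∣ b)) (sym (ℤ.pos-+ (∣ a ∣ ℕ.* ∣ a ∣) _))

‖‖-* : ∀ x y → ‖ x *ᵍ y ‖ ≡ ‖ x ‖ ℕ.* ‖ y ‖
‖‖-* x y = ℤ.+-injective (begin
  + ‖ x *ᵍ y ‖         ≡⟨ N≡‖‖ (x *ᵍ y) ⟨
  N (x *ᵍ y)           ≡⟨ N-* x y ⟩
  N x * N y            ≡⟨ cong₂ _*_ (N≡‖‖ x) (N≡‖‖ y) ⟩
  + ‖ x ‖ * + ‖ y ‖    ≡⟨ ℤ.pos-* ‖ x ‖ ‖ y ‖ ⟨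
  + (‖ x ‖ ℕ.* ‖ y ‖)  ∎)
  where open ≡-Reasoning

‖ι‖ : ∀ n → ‖ ι (+ n) ‖ ≡ n ℕ.* n
‖ι‖ n = ℕ.+-identityʳ (n ℕ.* n)

‖a+bi‖≡1⇒a≡0⊎b≡0 : ∀ a b → ‖ a + b 𝑖 ‖ ≡ 1 → a ≡ + 0 ⊎ b ≡ + 0
‖a+bi‖≡1⇒a≡0⊎b≡0 a b ‖ab‖≡1 with ∣ a ∣ in ∣a∣≡ | ∣ b ∣ in ∣b∣≡
... | zero  | _     = inj₁ (ℤ.∣i∣≡0⇒i≡0 ∣a∣≡)
... | suc _ | zero  = inj₂ (ℤ.∣i∣≡0⇒i≡0 ∣b∣≡)
... | suc m | suc n = contradiction (ℕ.suc-injective ‖ab‖≡1) (λ eq → ℕ.1+n≢0 (trans (sym (ℕ.+-suc _ _)) eq))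

*ᵍ-identityʳ : ∀ x → x ≡ x *ᵍ 1ᵍ
*ᵍ-identityʳ (a + b 𝑖) = cong₂ _+_𝑖 (re-eq a b) (im-eq a b)
  where
  re-eq : ∀ a b → a ≡ a * + 1 - b * + 0
  re-eq = solve-∀
  im-eq : ∀ a b → b ≡ a * + 0 + b * + 1
  im-eq = solve-∀

x≡x*n⇒n≡1 : ∀ x n .{{_ : ℕ.NonZero x}} → x ≡ x ℕ.* n → n ≡ 1
x≡x*n⇒n≡1 x n x≡xn = sym (ℕ.*-cancelˡ-≡ 1 n x (trans (ℕ.*-identityʳ x) x≡xn))

a≢0⇒‖a+bi‖≢0 : ∀ {a b} → a ≢ + 0 → ‖ a + b 𝑖 ‖ ≢ 0
a≢0⇒‖a+bi‖≢0 {a} a≢0 ‖a+bi‖≡0 =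
  a≢0 (ℤ.∣i∣≡0⇒i≡0 ([ id , id ]′ (ℕ.m*n≡0⇒m≡0∨n≡0 ∣ a ∣ (ℕ.m+n≡0⇒m≡0 (∣ a ∣ ℕ.* ∣ a ∣) ‖a+bi‖≡0))))

-- π ∣ g would make w a unit, while π ∣ w forces g = 1 on comparing norms
prime≡g*w⇒g≡1 : ∀ g {a b} .{{_ : ℕ.NonZero g}} → a ≢ + 0 → b ≢ + 0 →
  GaussianPrime (ι (+ g) *ᵍ (a + b 𝑖)) → g ≡ 1
prime≡g*w⇒g≡1 g {a} {b} a≢0 b≢0 (_ , _ , split) =
  [ ⊥-elim ∘ π∤g , π∣w⇒g≡1 ]′ (split (ι (+ g)) w (1ᵍ , *ᵍ-identityʳ π))
  where
  open ≡-Reasoning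
  w = a + b 𝑖
  π = ι (+ g) *ᵍ w
  ‖π‖≡g²‖w‖ : ‖ π ‖ ≡ g ℕ.* g ℕ.* ‖ w ‖
  ‖π‖≡g²‖w‖ = trans (‖‖-* (ι (+ g)) w) (cong (ℕ._* ‖ w ‖) (‖ι‖ g))
  π∣w⇒g≡1 : π ∣ᵍ w → g ≡ 1
  π∣w⇒g≡1 (t , w≡πt) = ℕ.m*n≡1⇒m≡1 g g (ℕ.m*n≡1⇒m≡1 (g ℕ.* g) ‖ t ‖
    (x≡x*n⇒n≡1 ‖ w ‖ (g ℕ.* g ℕ.* ‖ t ‖) {{ℕ.≢-nonZero (a≢0⇒‖a+bi‖≢0 {a} {b} a≢0)}} (begin
      ‖ w ‖                          ≡⟨ cong ‖_‖ w≡πt ⟩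
      ‖ π *ᵍ t ‖                     ≡⟨ ‖‖-* π t ⟩
      ‖ π ‖ ℕ.* ‖ t ‖                ≡⟨ cong (ℕ._* ‖ t ‖) ‖π‖≡g²‖w‖ ⟩
      g ℕ.* g ℕ.* ‖ w ‖ ℕ.* ‖ t ‖    ≡⟨ regroup (g ℕ.* g) ‖ w ‖ ‖ t ‖ ⟩
      ‖ w ‖ ℕ.* (g ℕ.* g ℕ.* ‖ t ‖)  ∎)))
    where
    regroup : ∀ G W T → G ℕ.* W ℕ.* T ≡ W ℕ.* (G ℕ.* T)
    regroup = ℕ-solve-∀
  π∤g : ¬ (π ∣ᵍ ι (+ g))
  π∤g (s , g≡πs) = [ a≢0 , b≢0 ]′ (‖a+bi‖≡1⇒a≡0⊎b≡0 a b (ℕ.m*n≡1⇒m≡1 ‖ w ‖ ‖ s ‖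
    (x≡x*n⇒n≡1 (g ℕ.* g) (‖ w ‖ ℕ.* ‖ s ‖) {{ℕ.m*n≢0 g g}} (begin
      g ℕ.* g                        ≡⟨ ‖ι‖ g ⟨
      ‖ ι (+ g) ‖                    ≡⟨ cong ‖_‖ g≡πs ⟩
      ‖ π *ᵍ s ‖                     ≡⟨ ‖‖-* π s ⟩
      ‖ π ‖ ℕ.* ‖ s ‖                ≡⟨ cong (ℕ._* ‖ s ‖) ‖π‖≡g²‖w‖ ⟩
      g ℕ.* g ℕ.* ‖ w ‖ ℕ.* ‖ s ‖    ≡⟨ ℕ.*-assoc (g ℕ.* g) ‖ w ‖ ‖ s ‖ ⟩
      g ℕ.* g ℕ.* (‖ w ‖ ℕ.* ‖ s ‖)  ∎))))

-- α · conj π = P (q₁ + q₂ i) and π · conj π = P, so α P = π (q₁ + q₂ i) P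
N∣α·conj⇒∣ᵍ : ∀ {u v a b} P .{{_ : ℤ.NonZero P}} → u * u + v * v ≡ P →
  P ∣ a * u + b * v → P ∣ b * u - a * v → (u + v 𝑖) ∣ᵍ (a + b 𝑖)
N∣α·conj⇒∣ᵍ {u} {v} {a} {b} P N≡P (divides q₁ au+bv≡q₁P) (divides q₂ bu-av≡q₂P) =
  q₁ + q₂ 𝑖 , cong₂ _+_𝑖 (ℤ.*-cancelʳ-≡ a _ P re-eq) (ℤ.*-cancelʳ-≡ b _ P im-eq)
  where
  open ≡-Reasoning
  re-eq : a * P ≡ (u * q₁ - v * q₂) * P
  re-eq = begin
    a * P                                     ≡⟨ cong (a *_) N≡P ⟨
    a * (u * u + v * v)                       ≡⟨ expand a b u v ⟩
    u * (a * u + b * v) - v * (b * u - a * v) ≡⟨ cong₂ (λ x y → u * x - v * y) au+bv≡q₁P bu-av≡q₂P ⟩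
    u * (q₁ * P) - v * (q₂ * P)               ≡⟨ collect u v q₁ q₂ P ⟩
    (u * q₁ - v * q₂) * P                     ∎
    where
    expand : ∀ a b u v → a * (u * u + v * v) ≡ u * (a * u + b * v) - v * (b * u - a * v)
    expand = solve-∀
    collect : ∀ u v q₁ q₂ P → u * (q₁ * P) - v * (q₂ * P) ≡ (u * q₁ - v * q₂) * P
    collect = solve-∀
  im-eq : b * P ≡ (u * q₂ + v * q₁) * P
  im-eq = begin
    b * P                                     ≡⟨ cong (b *_) N≡P ⟨
    b * (u * u + v * v)                       ≡⟨ expand a b u v ⟩
    u * (b * u - a * v) + v * (a * u + b * v) ≡⟨ cong₂ (λ x y → u * x + v * y) bu-av≡q₂P au+bv≡q₁P ⟩
    u * (q₂ * P) + v * (q₁ * P)               ≡⟨ collect u v q₁ q₂ P ⟩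
    (u * q₂ + v * q₁) * P                     ∎
    where
    expand : ∀ a b u v → b * (u * u + v * v) ≡ u * (b * u - a * v) + v * (a * u + b * v)
    expand = solve-∀
    collect : ∀ u v q₁ q₂ P → u * (q₂ * P) + v * (q₁ * P) ≡ (u * q₂ + v * q₁) * P
    collect = solve-∀

module GaussianPrimeOfNorm (u v : ℤ) (k : ℕ) (N≡p : N (u + v 𝑖) ≡ + suc (k ℕ.+ k))
                           (prime : GaussianPrime (u + v 𝑖)) (u≢0 : u ≢ + 0) (v≢0 : v ≢ + 0) where

  π : ℤ[i]
  π = u + v 𝑖

  p : ℤ
  p = + suc (k ℕ.+ k)

  ‖π‖≡p : ‖ π ‖ ≡ suc (k ℕ.+ k)
  ‖π‖≡p = ℤ.+-injective (trans (sym (N≡‖‖ π)) N≡p)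

  split : ∀ α β → π ∣ᵍ (α *ᵍ β) → (π ∣ᵍ α) ⊎ (π ∣ᵍ β)
  split = proj₂ (proj₂ prime)

  gcd[u,v]≡1 : gcd ∣ u ∣ ∣ v ∣ ≡ 1
  gcd[u,v]≡1 = prime≡g*w⇒g≡1 g a≢0 b≢0 (subst GaussianPrime π≡gw prime)
    where
    g = gcd ∣ u ∣ ∣ v ∣
    instance
      g≢0 : ℕ.NonZero g
      g≢0 = ℕ.≢-nonZero (gcd[m,n]≢0 ∣ u ∣ ∣ v ∣ (inj₁ (u≢0 ∘ ℤ.∣i∣≡0⇒i≡0)))
    g∣u = ∣ᵤ⇒∣ {+ g} {u} (gcd[m,n]∣m ∣ u ∣ ∣ v ∣)
    g∣v = ∣ᵤ⇒∣ {+ g} {v} (gcd[m,n]∣n ∣ u ∣ ∣ v ∣)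
    a = _∣_.quotient g∣u
    b = _∣_.quotient g∣v
    a≢0 : a ≢ + 0
    a≢0 a≡0 = u≢0 (trans (_∣_.equality g∣u) (cong (_* + g) a≡0))
    b≢0 : b ≢ + 0
    b≢0 b≡0 = v≢0 (trans (_∣_.equality g∣v) (cong (_* + g) b≡0))
    π≡gw : π ≡ ι (+ g) *ᵍ (a + b 𝑖)
    π≡gw = cong₂ _+_𝑖 (trans (_∣_.equality g∣u) (re-eq (+ g) a b)) (trans (_∣_.equality g∣v) (im-eq (+ g) a b))
      where
      re-eq : ∀ g a b → a * g ≡ g * a - + 0 * b
      re-eq = solve-∀
      im-eq : ∀ g a b → b * g ≡ g * b + + 0 * a
      im-eq = solve-∀

  π∣ι⇒p∣ : ∀ m → π ∣ᵍ ι m → p ∣ m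
  π∣ι⇒p∣ m ((c + d 𝑖) , ιm≡πγ) =
    ∣ᵤ⇒∣ (subst (suc (k ℕ.+ k) ℕ.∣_) ∣m∣*1≡∣m∣ (gcd-greatest (p∣∣m∣* c mu≡cp) (p∣∣m∣* (- d) mv≡-dp)))
    where
    open ≡-Reasoning
    m≡uc-vd : m ≡ u * c - v * d
    m≡uc-vd = cong re ιm≡πγ
    0≡ud+vc : + 0 ≡ u * d + v * c
    0≡ud+vc = cong im ιm≡πγ
    mu≡cp : m * u ≡ c * p
    mu≡cp = begin
      m * u                                  ≡⟨ cong (_* u) m≡uc-vd ⟩
      (u * c - v * d) * u                    ≡⟨ expand u v c d ⟩
      c * (u * u + v * v) - v * (u * d + v * c) ≡⟨ cong₂ (λ n z → c * n - v * z) N≡p (sym 0≡ud+vc) ⟩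
      c * p - v * + 0                        ≡⟨ cancel (c * p) v ⟩
      c * p                                  ∎
      where
      expand : ∀ u v c d → (u * c - v * d) * u ≡ c * (u * u + v * v) - v * (u * d + v * c)
      expand = solve-∀
      cancel : ∀ x v → x - v * + 0 ≡ x
      cancel = solve-∀
    mv≡-dp : m * v ≡ (- d) * p
    mv≡-dp = begin
      m * v                                  ≡⟨ cong (_* v) m≡uc-vd ⟩
      (u * c - v * d) * v                    ≡⟨ expand u v c d ⟩
      (- d) * (u * u + v * v) + u * (u * d + v * c) ≡⟨ cong₂ (λ n z → (- d) * n + u * z) N≡p (sym 0≡ud+vc) ⟩
      (- d) * p + u * + 0                    ≡⟨ cancel ((- d) * p) u ⟩
      (- d) * p                              ∎
      where
      expand : ∀ u v c d → (u * c - v * d) * v ≡ (- d) * (u * u + v * v) + u * (u * d + v * c)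
      expand = solve-∀
      cancel : ∀ x u → x + u * + 0 ≡ x
      cancel = solve-∀
    p∣∣m∣* : ∀ {x} q → m * x ≡ q * p → suc (k ℕ.+ k) ℕ.∣ ∣ m ∣ ℕ.* ∣ x ∣
    p∣∣m∣* {x} q mx≡qp = subst (suc (k ℕ.+ k) ℕ.∣_) (ℤ.abs-* m x) (∣⇒∣ᵤ (divides q mx≡qp))
    ∣m∣*1≡∣m∣ : gcd (∣ m ∣ ℕ.* ∣ u ∣) (∣ m ∣ ℕ.* ∣ v ∣) ≡ ∣ m ∣
    ∣m∣*1≡∣m∣ = trans (sym (c*gcd[m,n]≡gcd[cm,cn] (∣ m ∣) (∣ u ∣) (∣ v ∣)))
                  (trans (cong (∣ m ∣ ℕ.*_) gcd[u,v]≡1) (ℕ.*-identityʳ ∣ m ∣))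

  p∣⇒π∣ι : ∀ m → p ∣ m → π ∣ᵍ ι m
  p∣⇒π∣ι m (divides q m≡qp) = (q * u) + (- (q * v)) 𝑖 ,
    cong₂ _+_𝑖 (trans m≡qp (trans (cong (q *_) (sym N≡p)) (re-eq q u v))) (im-eq q u v)
    where
    re-eq : ∀ q u v → q * (u * u + v * v) ≡ u * (q * u) - v * (- (q * v))
    re-eq = solve-∀
    im-eq : ∀ q u v → + 0 ≡ u * (- (q * v)) + v * (q * u)
    im-eq = solve-∀

  euclid : Euclid p
  euclid a b p∣ab = Sum.map (π∣ι⇒p∣ a) (π∣ι⇒p∣ b)
    (split (ι a) (ι b) (subst (π ∣ᵍ_) (ι-* a b) (p∣⇒π∣ι (a * b) p∣ab)))

-- Quadratic characters of (ℤ[i]/p)ˣ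

module GaussianModuloPrime (k : ℕ) (k≥1 : 1 ≤ k) (euclid : Euclid (+ suc (k ℕ.+ k))) where

  open OddPrime k k≥1 euclid

  ≡ᵍ⇒≈ : ∀ {x y} → x ≡ᵍ y [mod ι p ] → re x ≈ re y × im x ≈ im y
  ≡ᵍ⇒≈ {a + b 𝑖} {c + d 𝑖} ((e + f 𝑖) , eq) =
    mod (divides e (trans (cong re eq) (re-eq p e f))) , mod (divides f (trans (cong im eq) (im-eq p e f)))
    where
    re-eq : ∀ p e f → p * e - + 0 * f ≡ e * p
    re-eq = solve-∀
    im-eq : ∀ p e f → p * f + + 0 * e ≡ f * p
    im-eq = solve-∀

  ι-cong : ∀ {a b} → a ≈ b → ι a ≡ᵍ ι b [mod ι p ]
  ι-cong (mod (divides q eq)) = ι q , cong₂ _+_𝑖 (trans eq (re-eq p q)) (im-eq p q)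
    where
    re-eq : ∀ p q → q * p ≡ p * q - + 0 * + 0
    re-eq = solve-∀
    im-eq : ∀ p q → + 0 + - (+ 0) ≡ p * + 0 + + 0 * q
    im-eq = solve-∀

  ℤ[i]/p : RawMonoid _ _
  ℤ[i]/p = record { Carrier = ℤ[i] ; _≈_ = _≡ᵍ_[mod ι p ] ; _∙_ = _*ᵍ_ ; ε = 1ᵍ }

  ℤ/p : RawMonoid _ _
  ℤ/p = record { Carrier = ℤ ; _≈_ = _≈_ ; _∙_ = _*_ ; ε = + 1 }

  IsMultiplicative : (ℤ[i] → ℤ) → Set
  IsMultiplicative = IsMonoidHomomorphism ℤ[i]/p ℤ/p

  N-isMultiplicative : IsMultiplicative N
  N-isMultiplicative = record
    { isMagmaHomomorphism = record
      { isRelHomomorphism = record { cong = λ {x} {y} → N-cong {x} {y} }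
      ; homo = λ x y → ≡⇒≈ (N-* x y) }
    ; ε-homo = ≈-refl }
    where
    N-cong : ∀ {x y} → x ≡ᵍ y [mod ι p ] → N x ≈ N y
    N-cong {a + b 𝑖} {c + d 𝑖} x≡y with ≡ᵍ⇒≈ {a + b 𝑖} {c + d 𝑖} x≡y
    ... | a≈c , b≈d = +-cong (*-cong a≈c a≈c) (*-cong b≈d b≈d)

  unit⇒p∤ : ∀ {f} → IsMultiplicative f → ∀ x → UnitMod (ι p) x → ¬ (p ∣ f x)
  unit⇒p∤ {f} f-mult x (y , xy≡1) p∣fx = 0≉1 (begin
    + 0 * f y     ≈⟨ *-cong (≈-sym (∣⇒≈0 p∣fx)) ≈-refl ⟩
    f x * f y     ≈⟨ homo x y ⟨
    f (x *ᵍ y)    ≈⟨ ⟦⟧-cong xy≡1 ⟩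
    f 1ᵍ          ≈⟨ ε-homo ⟩
    + 1           ∎)
    where
    open IsMonoidHomomorphism f-mult
    open ≈-Reasoning

  p∤N⇒unit : ∀ {x} → ¬ (p ∣ N x) → UnitMod (ι p) x
  p∤N⇒unit {x} p∤Nx = conj x *ᵍ ι (N x ⁻¹) ,
    subst (_≡ᵍ 1ᵍ [mod ι p ]) (sym (x*conj[x]*c≡ι[Nx*c] x (N x ⁻¹))) (ι-cong (⁻¹-inverse p∤Nx))
    where
    x*conj[x]*c≡ι[Nx*c] : ∀ x c → x *ᵍ (conj x *ᵍ ι c) ≡ ι (N x * c)
    x*conj[x]*c≡ι[Nx*c] (a + b 𝑖) c = cong₂ _+_𝑖 (re-eq a b c) (im-eq a b c)
      where
      re-eq : ∀ a b c → a * (a * c - (- b) * + 0) - b * (a * + 0 + (- b) * c) ≡ (a * a + b * b) * c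
      re-eq = solve-∀
      im-eq : ∀ a b c → a * (a * + 0 + (- b) * c) + b * (a * c - (- b) * + 0) ≡ + 0
      im-eq = solve-∀

  unit-* : ∀ x y → UnitMod (ι p) x → UnitMod (ι p) y → UnitMod (ι p) (x *ᵍ y)
  unit-* x y ux uy = p∤N⇒unit {x *ᵍ y} (λ p∣Nxy →
    [ unit⇒p∤ N-isMultiplicative x ux , unit⇒p∤ N-isMultiplicative y uy ]′ (euclid _ _ (subst (p ∣_) (N-* x y) p∣Nxy)))

  quadraticCharacter : ∀ {f χ} → IsMultiplicative f →
    (∀ x → UnitMod (ι p) x → SymbolValue (χ x) × f x ^ k ≈ χ x) → IsQuadraticCharacter (ι p) χ
  quadraticCharacter {f} {χ} f-mult χ≈f^k = well-defined , ±1 , multiplicative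
    where
    open IsMonoidHomomorphism f-mult
    value : ∀ x → UnitMod (ι p) x → SymbolValue (χ x)
    value x ux = proj₁ (χ≈f^k x ux)
    power : ∀ x → UnitMod (ι p) x → f x ^ k ≈ χ x
    power x ux = proj₂ (χ≈f^k x ux)
    well-defined : ∀ x y → UnitMod (ι p) x → UnitMod (ι p) y → x ≡ᵍ y [mod ι p ] → χ x ≡ χ y
    well-defined x y ux uy x≡y = symbolValue-≈⇒≡ (value x ux) (value y uy)
      (≈-trans (≈-sym (power x ux)) (≈-trans (^-cong k (⟦⟧-cong x≡y)) (power y uy)))
    ±1 : ∀ x → UnitMod (ι p) x → χ x ≡ + 1 ⊎ χ x ≡ - (+ 1)
    ±1 x ux with value x ux
    ... | inj₁ χx≡0 = contradiction (p∣a^n⇒p∣a k (≈0⇒∣ (subst (f x ^ k ≈_) χx≡0 (power x ux)))) (unit⇒p∤ f-mult x ux)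
    ... | inj₂ χx≡±1 = χx≡±1
    multiplicative : ∀ x y → UnitMod (ι p) x → UnitMod (ι p) y → χ (x *ᵍ y) ≡ χ x * χ y
    multiplicative x y ux uy = symbolValue-≈⇒≡ (value (x *ᵍ y) uxy) (symbolValue-* (value x ux) (value y uy)) (begin
      χ (x *ᵍ y)           ≈⟨ power (x *ᵍ y) uxy ⟨
      f (x *ᵍ y) ^ k       ≈⟨ ^-cong k (homo x y) ⟩
      (f x * f y) ^ k      ≡⟨ ^-distrib-* (f x) (f y) k ⟩
      f x ^ k * f y ^ k    ≈⟨ *-cong (power x ux) (power y uy) ⟩
      χ x * χ y            ∎)
      where
      open ≈-Reasoning
      uxy = unit-* x y ux uy

-- Reduction modulo π

module Reduction (u v : ℤ) (k : ℕ) (k≥1 : 1 ≤ k) (N≡p : N (u + v 𝑖) ≡ + suc (k ℕ.+ k))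
                 (prime : GaussianPrime (u + v 𝑖)) (u≢0 : u ≢ + 0) (v≢0 : v ≢ + 0) where

  open GaussianPrimeOfNorm u v k N≡p prime u≢0 v≢0 public
  open OddPrime k k≥1 euclid public hiding (p)
  open GaussianModuloPrime k k≥1 euclid public

  p∤v : ¬ (p ∣ v)
  p∤v p∣v = ℕ.<⇒≱ ∣v∣<p (ℕ.∣⇒≤ (∣⇒∣ᵤ p∣v))
    where
    instance
      ∣u∣≢0 : ℕ.NonZero ∣ u ∣
      ∣u∣≢0 = ℕ.≢-nonZero (u≢0 ∘ ℤ.∣i∣≡0⇒i≡0)
      ∣v∣≢0 : ℕ.NonZero ∣ v ∣
      ∣v∣≢0 = ℕ.≢-nonZero (v≢0 ∘ ℤ.∣i∣≡0⇒i≡0)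
    ∣v∣<p : ∣ v ∣ ℕ.< suc (k ℕ.+ k)
    ∣v∣<p = subst (∣ v ∣ ℕ.<_) ‖π‖≡p (ℕ.<-≤-trans (ℕ.m<n+m ∣ v ∣ (ℕ.>-nonZero⁻¹ _ {{ℕ.m*n≢0 ∣ u ∣ ∣ u ∣}}))
              (ℕ.+-monoʳ-≤ (∣ u ∣ ℕ.* ∣ u ∣) (ℕ.m≤m*n ∣ v ∣ ∣ v ∣)))

  -- J = -u/v is the image of i under ℤ[i] → ℤ[i]/(π) ≅ ℤ/p
  J : ℤ
  J = - (u * v ⁻¹)

  u+vJ≈0 : u + v * J ≈ + 0
  u+vJ≈0 = begin
    u + v * J                 ≡⟨ regroup u v (v ⁻¹) ⟩
    u - u * (v * v ⁻¹)        ≈⟨ +-congˡ u (-‿cong (*-congˡ u (⁻¹-inverse p∤v))) ⟩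
    u - u * + 1               ≡⟨ cancel u ⟩
    + 0                       ∎
    where
    open ≈-Reasoning
    regroup : ∀ u v w → u + v * - (u * w) ≡ u - u * (v * w)
    regroup = solve-∀
    cancel : ∀ u → u - u * + 1 ≡ + 0
    cancel = solve-∀

  J²+1≈0 : J * J + + 1 ≈ + 0
  J²+1≈0 = begin
    J * J + + 1                                     ≡⟨ regroup u v (v ⁻¹) ⟩
    (u * u + v * v) * (v ⁻¹ * v ⁻¹) - (v * v ⁻¹) * (v * v ⁻¹) + + 1
      ≈⟨ +-cong (+-cong (*-cong (≡⇒≈ N≡p) ≈-refl) (-‿cong (*-cong v*v⁻¹≈1 v*v⁻¹≈1))) ≈-refl ⟩
    p * (v ⁻¹ * v ⁻¹) - + 1 * + 1 + + 1             ≈⟨ +-cong (+-cong (∣⇒≈0 (∣m⇒∣m*n (v ⁻¹ * v ⁻¹) (∣-refl {p}))) ≈-refl) ≈-refl ⟩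
    + 0 - + 1 * + 1 + + 1                           ≡⟨⟩
    + 0                                             ∎
    where
    open ≈-Reasoning
    v*v⁻¹≈1 = ⁻¹-inverse p∤v
    regroup : ∀ u v w → - (u * w) * - (u * w) + + 1 ≡ (u * u + v * v) * (w * w) - (v * w) * (v * w) + + 1
    regroup = solve-∀

  reduce : ℤ[i] → ℤ
  reduce (a + b 𝑖) = a + b * J

  reduce-* : ∀ x y → reduce (x *ᵍ y) ≈ reduce x * reduce y
  reduce-* (a + b 𝑖) (c + d 𝑖) = begin
    (a * c - b * d) + (a * d + b * c) * J                   ≡⟨ expand a b c d J ⟩
    (a + b * J) * (c + d * J) - b * d * (J * J + + 1)       ≈⟨ +-congˡ ((a + b * J) * (c + d * J)) (-‿cong (*-congˡ (b * d) J²+1≈0)) ⟩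
    (a + b * J) * (c + d * J) - b * d * + 0                 ≡⟨ cancel ((a + b * J) * (c + d * J)) (b * d) ⟩
    (a + b * J) * (c + d * J)                               ∎
    where
    open ≈-Reasoning
    expand : ∀ a b c d J → (a * c - b * d) + (a * d + b * c) * J ≡ (a + b * J) * (c + d * J) - b * d * (J * J + + 1)
    expand = solve-∀
    cancel : ∀ x y → x - y * + 0 ≡ x
    cancel = solve-∀

  reduce-^ : ∀ x n → reduce (x ^ᵍ n) ≈ reduce x ^ n
  reduce-^ x zero    = ≈-refl
  reduce-^ x (suc n) = ≈-trans (reduce-* x (x ^ᵍ n)) (*-congˡ (reduce x) (reduce-^ x n))

  reduce-ι : ∀ a → reduce (ι a) ≡ a
  reduce-ι = ℤ.+-identityʳ

  reduce-- : ∀ x y → reduce (x -ᵍ y) ≡ reduce x - reduce y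
  reduce-- (a + b 𝑖) (c + d 𝑖) = regroup a b c d J
    where
    regroup : ∀ a b c d J → (a - c) + (b - d) * J ≡ (a + b * J) - (c + d * J)
    regroup = solve-∀

  π∣⇒p∣reduce : ∀ {α} → π ∣ᵍ α → p ∣ reduce α
  π∣⇒p∣reduce {α} (γ , refl) = ≈0⇒∣ (≈-trans (reduce-* π γ) (≈-trans (*-cong u+vJ≈0 (≈-refl {reduce γ})) (≡⇒≈ refl)))

  a+bJ≈0⇒au+bv≈0 : ∀ {a b} → a + b * J ≈ + 0 → a * u + b * v ≈ + 0
  a+bJ≈0⇒au+bv≈0 {a} {b} a+bJ≈0 = begin
    a * u + b * v                                                  ≡⟨ expand a b u v J ⟩
    u * (a + b * J) - b * J * (u + v * J) + b * v * (J * J + + 1)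
      ≈⟨ +-cong (+-cong (*-congˡ u a+bJ≈0) (-‿cong (*-congˡ (b * J) u+vJ≈0))) (*-congˡ (b * v) J²+1≈0) ⟩
    u * + 0 - b * J * + 0 + b * v * + 0                            ≡⟨ vanish u (b * J) (b * v) ⟩
    + 0                                                            ∎
    where
    open ≈-Reasoning
    expand : ∀ a b u v J → a * u + b * v ≡ u * (a + b * J) - b * J * (u + v * J) + b * v * (J * J + + 1)
    expand = solve-∀
    vanish : ∀ x y z → x * + 0 - y * + 0 + z * + 0 ≡ + 0
    vanish = solve-∀

  a+bJ≈0⇒bu-av≈0 : ∀ {a b} → a + b * J ≈ + 0 → b * u - a * v ≈ + 0
  a+bJ≈0⇒bu-av≈0 {a} {b} a+bJ≈0 = begin
    b * u - a * v                              ≡⟨ expand a b u v J ⟩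
    b * (u + v * J) - v * (a + b * J)          ≈⟨ +-cong (*-congˡ b u+vJ≈0) (-‿cong (*-congˡ v a+bJ≈0)) ⟩
    b * + 0 - v * + 0                          ≡⟨ vanish b v ⟩
    + 0                                        ∎
    where
    open ≈-Reasoning
    expand : ∀ a b u v J → b * u - a * v ≡ b * (u + v * J) - v * (a + b * J)
    expand = solve-∀
    vanish : ∀ x y → x * + 0 - y * + 0 ≡ + 0
    vanish = solve-∀

  p∣reduce⇒π∣ : ∀ {α} → p ∣ reduce α → π ∣ᵍ α
  p∣reduce⇒π∣ {a + b 𝑖} p∣a+bJ = N∣α·conj⇒∣ᵍ {u} {v} {a} {b} p N≡p
    (≈0⇒∣ (a+bJ≈0⇒au+bv≈0 {a} {b} a+bJ≈0)) (≈0⇒∣ (a+bJ≈0⇒bu-av≈0 {a} {b} a+bJ≈0))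
    where a+bJ≈0 = ∣⇒≈0 p∣a+bJ

  ≡ᵍ[π]⇒reduce≈ : ∀ {x y} → x ≡ᵍ y [mod π ] → reduce x ≈ reduce y
  ≡ᵍ[π]⇒reduce≈ {x} {y} π∣x-y = mod (subst (p ∣_) (reduce-- x y) (π∣⇒p∣reduce π∣x-y))

  reduce≈⇒≡ᵍ[π] : ∀ {x y} → reduce x ≈ reduce y → x ≡ᵍ y [mod π ]
  reduce≈⇒≡ᵍ[π] {x} {y} (mod p∣rx-ry) = p∣reduce⇒π∣ (subst (p ∣_) (sym (reduce-- x y)) p∣rx-ry)

  reduce-isMultiplicative : IsMultiplicative reduce
  reduce-isMultiplicative = record
    { isMagmaHomomorphism = record
      { isRelHomomorphism = record { cong = λ {x} {y} → reduce-cong {x} {y} }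
      ; homo = reduce-* }
    ; ε-homo = ≈-refl }
    where
    reduce-cong : ∀ {x y} → x ≡ᵍ y [mod ι p ] → reduce x ≈ reduce y
    reduce-cong {a + b 𝑖} {c + d 𝑖} x≡y with ≡ᵍ⇒≈ {a + b 𝑖} {c + d 𝑖} x≡y
    ... | a≈c , b≈d = +-cong a≈c (*-cong b≈d ≈-refl)

  exponent≡k : (∣ N π ∣ ℕ.∸ 1) ℕ./ 2 ≡ k
  exponent≡k = trans (cong (λ n → (∣ n ∣ ℕ.∸ 1) ℕ./ 2) N≡p)
                 (trans (cong (ℕ._/ 2) (k+k≡k*2 k)) (ℕ.m*n/n≡m k 2))
    where
    k+k≡k*2 : ∀ k → k ℕ.+ k ≡ k ℕ.* 2
    k+k≡k*2 = ℕ-solve-∀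

  symbol⇔power : ∀ x s → x ^ᵍ ((∣ N π ∣ ℕ.∸ 1) ℕ./ 2) ≡ᵍ ι s [mod π ] ⇔ reduce x ^ k ≈ s
  symbol⇔power x s rewrite exponent≡k = mk⇔
    (λ x^k≡s → ≈-trans (≈-sym (reduce-^ x k)) (subst (reduce (x ^ᵍ k) ≈_) (reduce-ι s) (≡ᵍ[π]⇒reduce≈ {x ^ᵍ k} {ι s} x^k≡s)))
    (λ r^k≈s → reduce≈⇒≡ᵍ[π] {x ^ᵍ k} {ι s} (≈-trans (reduce-^ x k) (subst (reduce x ^ k ≈_) (sym (reduce-ι s)) r^k≈s)))

  symbolMap-power : ∀ χ → IsSymbolMap π (ι p) χ → ∀ x → UnitMod (ι p) x → SymbolValue (χ x) × reduce x ^ k ≈ χ x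
  symbolMap-power χ S x ux = proj₁ (S x ux) , Equivalence.to (symbol⇔power x (χ x)) (proj₂ (S x ux))

  normLegendreMap-power : ∀ χ → IsNormLegendreMap p (ι p) χ → ∀ x → UnitMod (ι p) x → SymbolValue (χ x) × N x ^ k ≈ χ x
  normLegendreMap-power χ L x ux = legendre-symbolValue {N x} {p} (L x ux) , euler (L x ux)

  -- opaque, so that unification never runs the search for a non-square
  opaque
    a₀ : ℤ
    a₀ = proj₁ nonsquare

    a₀-nonsquare : Legendre a₀ p (- (+ 1))
    a₀-nonsquare = proj₂ nonsquare

  p∤a₀ : ¬ (p ∣ a₀)
  p∤a₀ = legendre-1⇒p∤ a₀-nonsquare

  a₀^k≈-1 : a₀ ^ k ≈ - (+ 1)
  a₀^k≈-1 = euler a₀-nonsquare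

  ι[a₀]-unit : UnitMod (ι p) (ι a₀)
  ι[a₀]-unit = p∤N⇒unit {ι a₀} (p∤square p∤a₀ ∘ subst (p ∣_) (ℤ.+-identityʳ (a₀ * a₀)))

  -- reduce w ≈ a₀ and reduce (conj w) ≈ 1, so N w = w · conj w reduces to a₀
  w : ℤ[i]
  w = ((a₀ + + 1) * K) + (- ((a₀ - + 1) * K * J)) 𝑖
    where K = + suc k

  Nw≈a₀ : N w ≈ a₀
  Nw≈a₀ = begin
    N w                                                              ≡⟨ expand a₀ K J ⟩
    (K + K) * (K + K) * a₀ + K * K * (a₀ - + 1) * (a₀ - + 1) * (J * J + + 1)
      ≈⟨ +-cong (*-cong (*-cong 2K≈1 2K≈1) (≈-refl {a₀})) (*-congˡ (K * K * (a₀ - + 1) * (a₀ - + 1)) J²+1≈0) ⟩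
    + 1 * + 1 * a₀ + K * K * (a₀ - + 1) * (a₀ - + 1) * + 0           ≡⟨ simplify a₀ (K * K * (a₀ - + 1) * (a₀ - + 1)) ⟩
    a₀                                                               ∎
    where
    open ≈-Reasoning
    K = + suc k
    expand : ∀ a K J → ((a + + 1) * K) * ((a + + 1) * K) + (- ((a - + 1) * K * J)) * (- ((a - + 1) * K * J))
                       ≡ (K + K) * (K + K) * a + K * K * (a - + 1) * (a - + 1) * (J * J + + 1)
    expand = solve-∀
    simplify : ∀ a c → + 1 * + 1 * a + c * + 0 ≡ a
    simplify = solve-∀
    2K≈1 : K + K ≈ + 1
    2K≈1 = mod (divides (+ 1) (2[1+k]-1≡2k+1 (+ k)))
      where
      2[1+k]-1≡2k+1 : ∀ k → (+ 1 + k) + (+ 1 + k) - + 1 ≡ + 1 * (+ 1 + (k + k))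
      2[1+k]-1≡2k+1 = solve-∀

  w-unit : UnitMod (ι p) w
  w-unit = p∤N⇒unit {w} (λ p∣Nw → p∤a₀ (≈0⇒∣ (≈-trans (≈-sym Nw≈a₀) (∣⇒≈0 p∣Nw))))

  symbolMap-at-a₀ : ∀ χ → IsSymbolMap π (ι p) χ → χ (ι a₀) ≡ - (+ 1)
  symbolMap-at-a₀ χ S = symbolValue-≈⇒≡ {χ (ι a₀)} (proj₁ P) (inj₂ (inj₂ refl))
    (≈-trans {χ (ι a₀)} {reduce (ι a₀) ^ k} (≈-sym {reduce (ι a₀) ^ k} (proj₂ P))
      (subst (λ a → a ^ k ≈ - (+ 1)) (sym (reduce-ι a₀)) a₀^k≈-1))
    where P = symbolMap-power χ S (ι a₀) ι[a₀]-unit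

  normLegendreMap-at-a₀ : ∀ χ → IsNormLegendreMap p (ι p) χ → χ (ι a₀) ≡ + 1
  normLegendreMap-at-a₀ χ L = symbolValue-≈⇒≡ {χ (ι a₀)} (proj₁ P) (inj₂ (inj₁ refl))
    (≈-trans {χ (ι a₀)} {N (ι a₀) ^ k} (≈-sym {N (ι a₀) ^ k} (proj₂ P))
      (subst (λ a → a ^ k ≈ + 1) (sym (ℤ.+-identityʳ (a₀ * a₀))) (square^k≈1 p∤a₀)))
    where P = normLegendreMap-power χ L (ι a₀) ι[a₀]-unit

  normLegendreMap-at-w : ∀ χ → IsNormLegendreMap p (ι p) χ → χ w ≡ - (+ 1)
  normLegendreMap-at-w χ L = symbolValue-≈⇒≡ {χ w} (proj₁ P) (inj₂ (inj₂ refl))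
    (≈-trans {χ w} {N w ^ k} (≈-sym {N w ^ k} (proj₂ P)) (≈-trans (^-cong k Nw≈a₀) a₀^k≈-1))
    where P = normLegendreMap-power χ L w w-unit

  symbolCharacter : ℤ[i] → ℤ
  symbolCharacter x = proj₁ (legendre (reduce x))

  normCharacter : ℤ[i] → ℤ
  normCharacter x = proj₁ (legendre (N x))

  symbolCharacter-isSymbolMap : IsSymbolMap π (ι p) symbolCharacter
  symbolCharacter-isSymbolMap x _ =
    legendre-symbolValue {reduce x} {p} L , Equivalence.from (symbol⇔power x (symbolCharacter x)) (euler L)
    where L = proj₂ (legendre (reduce x))

  normCharacter-isNormLegendreMap : IsNormLegendreMap p (ι p) normCharacter
  normCharacter-isNormLegendreMap x _ = proj₂ (legendre (N x))

  two-characters : (∃ λ χ₁ → ∃ λ χ₂ → IsSymbolMap π (ι p) χ₁ × IsNormLegendreMap p (ι p) χ₂)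
    × (∀ χ₁ χ₂ → IsSymbolMap π (ι p) χ₁ → IsNormLegendreMap p (ι p) χ₂ → DifferentNonTrivialQuadChars (ι p) χ₁ χ₂)
  two-characters =
    (symbolCharacter , normCharacter , symbolCharacter-isSymbolMap , normCharacter-isNormLegendreMap) ,
    λ χ₁ χ₂ S L →
        quadraticCharacter {reduce} {χ₁} reduce-isMultiplicative (symbolMap-power χ₁ S)
      , quadraticCharacter {N} {χ₂} N-isMultiplicative (normLegendreMap-power χ₂ L)
      , (ι a₀ , ι[a₀]-unit , λ χ₁≡1 → -1≢1 (trans (sym (symbolMap-at-a₀ χ₁ S)) χ₁≡1))
      , (w , w-unit , λ χ₂≡1 → -1≢1 (trans (sym (normLegendreMap-at-w χ₂ L)) χ₂≡1))
      , (ι a₀ , ι[a₀]-unit , λ χ₁≡χ₂ → -1≢1 (trans (sym (symbolMap-at-a₀ χ₁ S)) (trans χ₁≡χ₂ (normLegendreMap-at-a₀ χ₂ L))))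
    where
    -1≢1 : - (+ 1) ≢ + 1
    -1≢1 ()

-- Primary primes

∣1+2m∣-odd : ∀ m → ∃ λ t → ∣ + 1 + + 2 * m ∣ ≡ suc (t ℕ.+ t)
∣1+2m∣-odd (+ n)      = n , trans (cong (λ z → ∣ + 1 + z ∣) (sym (ℤ.pos-* 2 n))) (cong (λ x → suc (n ℕ.+ x)) (ℕ.+-identityʳ n))
∣1+2m∣-odd ℤ.-[1+ n ] = n , trans (cong ∣_∣ (negate (+ n))) (trans (ℤ.∣-i∣≡∣i∣ (+ 1 + + 2 * + n)) (proj₂ (∣1+2m∣-odd (+ n))))
  where
  negate : ∀ m → + 1 + + 2 * (- (+ 1 + m)) ≡ - (+ 1 + + 2 * m)
  negate = solve-∀

primary⇒ : ∀ {u v} → Primary (u + v 𝑖) → ∃ λ m → ∃ λ n → u ≡ + 1 + + 2 * m × v ≡ + 2 * n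
primary⇒ {u} {v} ((e + f 𝑖) , π-1≡[2+2i]γ) =
  e - f , e + f , re-eq u e f (cong re π-1≡[2+2i]γ) , im-eq v e f (cong im π-1≡[2+2i]γ)
  where
  re-eq : ∀ u e f → u + - (+ 1) ≡ + 2 * e - + 2 * f → u ≡ + 1 + + 2 * (e - f)
  re-eq u e f eq = trans (shift u) (trans (cong (_+_ (+ 1)) eq) (factor e f))
    where
    shift : ∀ u → u ≡ + 1 + (u + - (+ 1))
    shift = solve-∀
    factor : ∀ e f → + 1 + (+ 2 * e - + 2 * f) ≡ + 1 + + 2 * (e - f)
    factor = solve-∀
  im-eq : ∀ v e f → v + - (+ 0) ≡ + 2 * f + + 2 * e → v ≡ + 2 * (e + f)
  im-eq v e f eq = trans (sym (ℤ.+-identityʳ v)) (trans eq (factor e f))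
    where
    factor : ∀ e f → + 2 * f + + 2 * e ≡ + 2 * (e + f)
    factor = solve-∀

primary⇒re≢0 : ∀ {u v} → Primary (u + v 𝑖) → u ≢ + 0
primary⇒re≢0 {u} {v} pr u≡0 with primary⇒ {u} {v} pr
... | m , _ , u≡1+2m , _ with ∣1+2m∣-odd m
...   | t , ∣1+2m∣≡1+2t = ℕ.1+n≢0 (trans (sym ∣1+2m∣≡1+2t) (cong ∣_∣ (trans (sym u≡1+2m) u≡0)))

primary⇒norm : ∀ {u v} → Primary (u + v 𝑖) → v ≢ + 0 → ∃ λ k → 1 ≤ k × N (u + v 𝑖) ≡ + suc (k ℕ.+ k)
primary⇒norm {u} {v} pr v≢0 with primary⇒ {u} {v} pr
... | m , n , u≡1+2m , v≡2n with ∣1+2m∣-odd m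
...   | t , ∣1+2m∣≡1+2t = A ℕ.+ A , 1≤A+A , trans (N≡‖‖ (u + v 𝑖)) (cong +_ ‖π‖≡1+2k)
  where
  s = ∣ n ∣
  A = t ℕ.* t ℕ.+ t ℕ.+ s ℕ.* s
  ∣v∣≡2s : ∣ v ∣ ≡ s ℕ.+ s
  ∣v∣≡2s = trans (cong ∣_∣ v≡2n) (trans (ℤ.abs-* (+ 2) n) (cong (s ℕ.+_) (ℕ.+-identityʳ s)))
  ‖π‖≡1+2k : ‖ u + v 𝑖 ‖ ≡ suc (A ℕ.+ A ℕ.+ (A ℕ.+ A))
  ‖π‖≡1+2k = trans (cong₂ (λ a b → a ℕ.* a ℕ.+ b ℕ.* b) (trans (cong ∣_∣ u≡1+2m) ∣1+2m∣≡1+2t) ∣v∣≡2s) (expand t s)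
    where
    expand : ∀ t s → suc (t ℕ.+ t) ℕ.* suc (t ℕ.+ t) ℕ.+ (s ℕ.+ s) ℕ.* (s ℕ.+ s)
                     ≡ suc ((t ℕ.* t ℕ.+ t ℕ.+ s ℕ.* s) ℕ.+ (t ℕ.* t ℕ.+ t ℕ.+ s ℕ.* s)
                            ℕ.+ ((t ℕ.* t ℕ.+ t ℕ.+ s ℕ.* s) ℕ.+ (t ℕ.* t ℕ.+ t ℕ.+ s ℕ.* s)))
    expand = ℕ-solve-∀
  instance
    s≢0 : ℕ.NonZero s
    s≢0 = ℕ.≢-nonZero (λ s≡0 → v≢0 (trans v≡2n (cong (+ 2 *_) (ℤ.∣i∣≡0⇒i≡0 {n} s≡0))))
  1≤s*s : 1 ≤ s ℕ.* s
  1≤s*s = ℕ.>-nonZero⁻¹ (s ℕ.* s) {{ℕ.m*n≢0 s s}}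
  1≤A+A : 1 ≤ A ℕ.+ A
  1≤A+A = ℕ.≤-trans 1≤s*s (ℕ.≤-trans (ℕ.m≤n+m (s ℕ.* s) (t ℕ.* t ℕ.+ t)) (ℕ.m≤m+n A A))

lemma5p9 : ∀ (π : ℤ[i]) → Primary π → GaussianPrime π → + 0 < im π →
    (∃ λ χ₁ → ∃ λ χ₂ → IsSymbolMap π (ι (N π)) χ₁ × IsNormLegendreMap (N π) (ι (N π)) χ₂)
    × (∀ χ₁ χ₂ → IsSymbolMap π (ι (N π)) χ₁ → IsNormLegendreMap (N π) (ι (N π)) χ₂ →
         DifferentNonTrivialQuadChars (ι (N π)) χ₁ χ₂)
lemma5p9 (u + v 𝑖) primary prime 0<v =
  let k , k≥1 , N≡p = primary⇒norm {u} {v} primary v≢0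
  in subst Claim (sym N≡p) (Reduction.two-characters u v k k≥1 N≡p prime (primary⇒re≢0 {u} {v} primary) v≢0)
  where
  v≢0 : v ≢ + 0
  v≢0 = ℤ.<⇒≢ 0<v ∘ sym
  Claim : ℤ → Set
  Claim P = (∃ λ χ₁ → ∃ λ χ₂ → IsSymbolMap (u + v 𝑖) (ι P) χ₁ × IsNormLegendreMap P (ι P) χ₂)
    × (∀ χ₁ χ₂ → IsSymbolMap (u + v 𝑖) (ι P) χ₁ → IsNormLegendreMap P (ι P) χ₂ →
         DifferentNonTrivialQuadChars (ι P) χ₁ χ₂)
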